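{- There is an absolute constant $c>0$ such that the following holds for every alphabet size $\sigma\ge 2$ and every integer $r\ge 2$. There is an injective encoding that maps the light transitions of any segment of size $r$ of any segment automaton over an alphabet of size $\sigma$ to a bit string of length at most $c\,r\log\sigma$. The light transitions to be encoded are the labels of all light forward transitions, together with, for each state, whether its failure transition is light and, if so, its target; states are numbered locally $0,\dots,r-1$.
   Context: Strings are indexed from $1$. $A[i]$ denotes the $i$-th character of $A$ and $A[i,j]$ the substring from position $i$ to position $j$. KMP automaton $K(P)$ of a pattern $P$ of length $m$. Its states are $0,\dots,m$. - For $0\le s<m$ there is a forward transition from $s$ to $s+1$ labeled $P[s+1]$. - For $0<s\le m$ there is a failure transition from $s$ to $\mathrm{fail}(s)$, where $P[1,\mathrm{fail}(s)]$ is the longest prefix of $P$ that is a proper suffix of $P[1,s]$. Segments and light transitions. For an even parameter $r$, the segment automaton $C(P,r)$ partitions the states of $K(P)$ into overlapping segments (intervals of consecutive states) $S_i=[l_i,r_i]$ with $l_i=i\cdot r/2$ and $r_i=\min(l_i+r-1,m)$. Each state $s\in S_i$ is represented by a local state $s-l_i$. A transition $(s,s')$ of $K(P)$ with $s\in S_i$ is light within $S_i$ if $s'\in S_i$, and then it connects the local states $s-l_i$ and $s'-l_i$. A segment of size $r$ is one with $r_i-l_i+1=r$. -}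

module Defs where

open import Data.Nat using (ℕ; zero; suc; _+_; _*_; _∸_; _≤_; _<_; _≤?_; _<?_; _⊓_)
open import Data.Nat.Logarithm using (⌈log₂_⌉)
open import Data.Fin using (Fin; toℕ) renaming (zero to fzero; suc to fsuc)
open import Data.Fin.Properties using () renaming (_≟_ to _≟ᶠ_)
open import Data.List using (List; []; _∷_; take; drop; length)
open import Data.List.Properties using (≡-dec)
open import Data.Vec using (Vec; tabulate)
open import Data.Maybe using (Maybe; just; nothing; map)
open import Data.Bool using (Bool)
open import Data.Product using (_×_; _,_; ∃; ∃-syntax)
open import Relation.Nullary using (yes; no)
open import Relation.Binary.PropositionalEquality using (_≡_)

Pattern : ℕ → Set
Pattern σ = List (Fin σ)

-- 0-indexed safe lookup: at P p = just P[p+1] (1-indexed) if it exists.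
at : ∀ {A : Set} → List A → ℕ → Maybe A
at []       _       = nothing
at (x ∷ xs) zero    = just x
at (x ∷ xs) (suc p) = at xs p

toFin : (n k : ℕ) → Maybe (Fin n)
toFin zero    _       = nothing
toFin (suc n) zero    = just fzero
toFin (suc n) (suc k) = map fsuc (toFin n k)

-- P[1,k] is a suffix of P[1,s]  (i.e. P[1,k] = P[s-k+1,s]).
isBorder : ∀ {σ} → Pattern σ → ℕ → ℕ → Bool
isBorder P s k with ≡-dec _≟ᶠ_ (take k P) (drop (s ∸ k) (take s P))
... | yes _ = Bool.true
... | no  _ = Bool.false

searchBorder : ∀ {σ} → Pattern σ → ℕ → ℕ → ℕ
searchBorder P s zero    = zero
searchBorder P s (suc k) with isBorder P s (suc k)
... | Bool.true  = suc k
... | Bool.false = searchBorder P s k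

-- fail(s) for 0 < s ≤ m: length of the longest prefix of P that is a
-- proper suffix of P[1,s].
fail : ∀ {σ} → Pattern σ → ℕ → ℕ
fail P s = searchBorder P s (s ∸ 1)

-- Light transitions of a segment [l, l+r-1], in local numbering 0..r-1.
--  * forward component: entry j is  just (label)  iff the forward transition
--    from local state j is light (exists and stays in the segment);
--  * failure component: entry j is  just (local target)  iff state l+j has a
--    failure transition and it is light.
LightData : ℕ → ℕ → Set
LightData σ r = Vec (Maybe (Fin σ)) r × Vec (Maybe (Fin r)) r

lightForward : ∀ {σ} → Pattern σ → (l r : ℕ) → Fin r → Maybe (Fin σ)
lightForward P l r j with suc (toℕ j) <? r | l + toℕ j <? length P
... | yes _ | yes _ = at P (l + toℕ j)
... | _     | _     = nothing

lightFail : ∀ {σ} → Pattern σ → (l r : ℕ) → Fin r → Maybe (Fin r)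
lightFail P l r j with l + toℕ j
... | zero  = nothing
... | suc s with l ≤? fail P (suc s)
...   | yes _ = toFin r (fail P (suc s) ∸ l)
...   | no  _ = nothing

lightData : ∀ {σ} → Pattern σ → (l r : ℕ) → LightData σ r
lightData P l r = tabulate (lightForward P l r) , tabulate (lightFail P l r)

-- d is the light-transition data of a segment of size r of some segment
-- automaton C(P, r') over alphabet size σ (r' = 2h even, h ≥ 1):
-- segment S_i = [l_i, r_i], l_i = i·h, r_i = min(l_i + r' - 1, m),
-- and r_i - l_i + 1 = r.
Realizable : (σ r : ℕ) → LightData σ r → Set
Realizable σ r d =
  ∃[ h ] ∃[ P ] ∃[ i ]
    ( 1 ≤ h
    × i * h ≤ length {A = Fin σ} P
    × ((i * h + 2 * h ∸ 1) ⊓ length P) + 1 ≡ i * h + r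
    × d ≡ lightData {σ} P (i * h) r )

module Submission where

-- Forward labels cost ⌈log₂ σ⌉ + 1 bits each.  A
-- naive coding of the failure targets would cost log r bits each, which
-- may exceed O(log σ); instead each target is coded by its offset from
-- the previous target plus one, in unary with a sign bit.  Since the KMP
-- failure function satisfies fail(s + 1) ≤ fail(s) + 1, every target lies
-- at or below its reference point, and an amortised (potential) argument
-- bounds the failure part by 5 r bits, giving 7 r ⌈log₂ σ⌉ in total.

open import Defs
open import Data.Nat using (ℕ; _*_; _≤_; _<_)
open import Data.Nat.Logarithm using (⌈log₂_⌉)
open import Data.List using (List; length)
open import Data.Bool using (Bool)
open import Data.Product using (_×_; Σ)
open import Relation.Binary.PropositionalEquality using (_≡_)

open import Data.Nat using (zero; suc; _+_; _∸_; _^_; _⊓_; z≤n; s≤s; s≤s⁻¹; _≤?_; ⌈_/2⌉)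
open import Data.Nat.Properties
open import Algebra.Properties.CommutativeSemigroup +-commutativeSemigroup using (x∙yz≈y∙xz)
open import Data.Nat.Induction using (<-rec)
open import Data.Nat.Logarithm using (⌈log₂⌉-mono-≤; ⌈log₂⌈n/2⌉⌉≡⌈log₂n⌉∸1; ⌈log₂2^n⌉≡n)
open import Data.Nat.Solver using (module +-*-Solver)
open import Data.Fin using (Fin; toℕ; inject₁; inject≤; remQuot; combine) renaming (zero to fzero; suc to fsuc)
open import Data.Fin.Properties using (toℕ<n; toℕ-inject₁; toℕ-injective; inject≤-injective; combine-remQuot) renaming (_≟_ to _≟ᶠ_)
open import Data.List using ([]; _∷_; _++_; take; drop)
open import Data.List.Properties using (≡-dec; ∷-injectiveˡ; ∷-injectiveʳ; ++-assoc; ++-identityʳ; length-++; take-take; take-drop)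
open import Data.Vec using (Vec; tabulate) renaming ([] to []ᵛ; _∷_ to _∷ᵛ_)
open import Data.Maybe using (Maybe; just; nothing)
open import Data.Bool using (true; false)
open import Data.Product using (_,_; proj₁; proj₂; uncurry)
open import Data.Unit using (⊤; tt)
open import Data.Empty using (⊥-elim)
open import Data.Sum using (inj₁; inj₂)
open import Function using (_∘_)
open import Function.Definitions using (Injective)
open import Relation.Nullary using (yes; no)
open import Relation.Binary.PropositionalEquality using (refl; sym; trans; cong; cong₂; subst; module ≡-Reasoning)

-- A code is prefix-free when a code word can be split
-- off the front of any bit string in at most one way; concatenations of
-- prefix-free codes are then uniquely decodable, hence injective.

PrefixFree : {A : Set} → (A → List Bool) → Set
PrefixFree {A} code = ∀ (a b : A) xs ys → code a ++ xs ≡ code b ++ ys → a ≡ b × xs ≡ ys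

prefixFree⇒injective : ∀ {A : Set} {code : A → List Bool} → PrefixFree code →
                       ∀ a b → code a ≡ code b → a ≡ b
prefixFree⇒injective {code = code} pf a b e =
  proj₁ (pf a b [] [] (trans (++-identityʳ (code a)) (trans e (sym (++-identityʳ (code b))))))

split-equal-length : ∀ {A : Set} (as bs xs ys : List A) → length as ≡ length bs →
                     as ++ xs ≡ bs ++ ys → as ≡ bs × xs ≡ ys
split-equal-length []       []       xs ys _ e = refl , e
split-equal-length (a ∷ as) (b ∷ bs) xs ys l e
  with split-equal-length as bs xs ys (suc-injective l) (∷-injectiveʳ e)
... | as≡bs , xs≡ys = cong₂ _∷_ (∷-injectiveˡ e) as≡bs , xs≡ys

fixedLength-prefixFree : ∀ {A : Set} {code : A → List Bool} (k : ℕ) →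
                         (∀ a → length (code a) ≡ k) → Injective _≡_ _≡_ code → PrefixFree code
fixedLength-prefixFree {code = code} k len inj a b xs ys e
  with split-equal-length (code a) (code b) xs ys (trans (len a) (sym (len b))) e
... | ca≡cb , xs≡ys = inj ca≡cb , xs≡ys

∘-prefixFree : ∀ {A B : Set} {code : B → List Bool} {f : A → B} →
               PrefixFree code → Injective _≡_ _≡_ f → PrefixFree (code ∘ f)
∘-prefixFree pf inj a b xs ys e with pf _ _ xs ys e
... | fa≡fb , xs≡ys = inj fa≡fb , xs≡ys

maybeCode : {A : Set} → (A → List Bool) → Maybe A → List Bool
maybeCode code nothing  = false ∷ []
maybeCode code (just a) = true ∷ code a

maybeCode-prefixFree : ∀ {A : Set} {code : A → List Bool} → PrefixFree code → PrefixFree (maybeCode code)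
maybeCode-prefixFree pf nothing  nothing  xs ys e = refl , ∷-injectiveʳ e
maybeCode-prefixFree pf (just a) (just b) xs ys e with pf a b xs ys (∷-injectiveʳ e)
... | refl , xs≡ys = refl , xs≡ys

pairCode : {A B : Set} → (A → List Bool) → (B → List Bool) → A × B → List Bool
pairCode code₁ code₂ (a , b) = code₁ a ++ code₂ b

pairCode-prefixFree : ∀ {A B : Set} {code₁ : A → List Bool} {code₂ : B → List Bool} →
                      PrefixFree code₁ → PrefixFree code₂ → PrefixFree (pairCode code₁ code₂)
pairCode-prefixFree {code₁ = code₁} {code₂} pf₁ pf₂ (a , b) (a′ , b′) xs ys e
  with pf₁ a a′ (code₂ b ++ xs) (code₂ b′ ++ ys)
         (trans (sym (++-assoc (code₁ a) (code₂ b) xs)) (trans e (++-assoc (code₁ a′) (code₂ b′) ys)))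
... | refl , rest with pf₂ b b′ xs ys rest
...   | refl , xs≡ys = refl , xs≡ys

-- Along
-- "admissible" vectors the length is bounded by an amortised argument with
-- a potential φ on states: an entry costing more than k bits must lower the
-- potential accordingly.
module Chain {S A : Set} (code : S → A → List Bool) (next : A → S) (Adm : S → A → Set) where

  chain : ∀ {n} → S → Vec A n → List Bool
  chain p []ᵛ       = []
  chain p (x ∷ᵛ v) = code p x ++ chain (next x) v

  chain-prefixFree : (∀ p → PrefixFree (code p)) → ∀ {n} p → PrefixFree (chain {n} p)
  chain-prefixFree pf p []ᵛ       []ᵛ         xs ys e = refl , e
  chain-prefixFree pf p (x ∷ᵛ v) (x′ ∷ᵛ v′) xs ys e
    with pf p x x′ (chain (next x) v ++ xs) (chain (next x′) v′ ++ ys)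
           (trans (sym (++-assoc (code p x) _ xs)) (trans e (++-assoc (code p x′) _ ys)))
  ... | refl , rest with chain-prefixFree pf (next x) v v′ xs ys rest
  ...   | refl , xs≡ys = refl , xs≡ys

  Admissible : ∀ {n} → S → Vec A n → Set
  Admissible p []ᵛ       = ⊤
  Admissible p (x ∷ᵛ v) = Adm p x × Admissible (next x) v

  tabulate-admissible : ∀ {n} p (f : Fin (suc n) → A) → Adm p (f fzero) →
                        (∀ (i : Fin n) → Adm (next (f (inject₁ i))) (f (fsuc i))) →
                        Admissible p (tabulate f)
  tabulate-admissible {zero}  p f adm₀ adm = adm₀ , tt
  tabulate-admissible {suc n} p f adm₀ adm =
    adm₀ , tabulate-admissible (next (f fzero)) (f ∘ fsuc) (adm fzero) (adm ∘ fsuc)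

  chain-length : (φ : S → ℕ) (k : ℕ) →
                 (∀ p x → Adm p x → length (code p x) + φ (next x) ≤ k + φ p) →
                 ∀ {n} p (v : Vec A n) → Admissible p v → length (chain p v) ≤ n * k + φ p
  chain-length φ k cost p []ᵛ       _            = z≤n
  chain-length φ k cost {suc n} p (x ∷ᵛ v) (adm , adms) = begin
    length (code p x ++ chain (next x) v)            ≡⟨ length-++ (code p x) ⟩
    length (code p x) + length (chain (next x) v)    ≤⟨ +-monoʳ-≤ (length (code p x)) (chain-length φ k cost (next x) v adms) ⟩
    length (code p x) + (n * k + φ (next x))         ≡⟨ x∙yz≈y∙xz (length (code p x)) (n * k) (φ (next x)) ⟩
    n * k + (length (code p x) + φ (next x))         ≤⟨ +-monoʳ-≤ (n * k) (cost p x adm) ⟩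
    n * k + (k + φ p)                                ≡⟨ sym (+-assoc (n * k) k (φ p)) ⟩
    n * k + k + φ p                                  ≡⟨ cong (_+ φ p) (+-comm (n * k) k) ⟩
    suc n * k + φ p                                  ∎
    where
    open ≤-Reasoning

bit : Fin 2 → Bool
bit fzero    = false
bit (fsuc _) = true

bit-injective : Injective _≡_ _≡_ bit
bit-injective {fzero}        {fzero}        _ = refl
bit-injective {fsuc fzero}   {fsuc fzero}   _ = refl
bit-injective {fzero}        {fsuc _}      ()
bit-injective {fsuc _}       {fzero}       ()

bits : ∀ k → Fin (2 ^ k) → List Bool
bits zero    _ = []
bits (suc k) i = bit (proj₁ (remQuot {2} (2 ^ k) i)) ∷ bits k (proj₂ (remQuot {2} (2 ^ k) i))

length-bits : ∀ k (i : Fin (2 ^ k)) → length (bits k i) ≡ k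
length-bits zero    _ = refl
length-bits (suc k) i = cong suc (length-bits k _)

bits-injective : ∀ k → Injective _≡_ _≡_ (bits k)
bits-injective zero    {fzero} {fzero} _ = refl
bits-injective (suc k) {i} {j} e = begin
  i                                   ≡⟨ sym (combine-remQuot {2} (2 ^ k) i) ⟩
  uncurry combine (remQuot {2} (2 ^ k) i) ≡⟨ cong (uncurry combine) (cong₂ _,_ high low) ⟩
  uncurry combine (remQuot {2} (2 ^ k) j) ≡⟨ combine-remQuot {2} (2 ^ k) j ⟩
  j                                   ∎
  where
  open ≡-Reasoning
  high = bit-injective (∷-injectiveˡ e)
  low  = bits-injective k (∷-injectiveʳ e)

letterCode : ∀ {σ} L → σ ≤ 2 ^ L → Fin σ → List Bool
letterCode L σ≤2^L a = bits L (inject≤ a σ≤2^L)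

letterCode-prefixFree : ∀ {σ} L (σ≤2^L : σ ≤ 2 ^ L) → PrefixFree (letterCode L σ≤2^L)
letterCode-prefixFree L σ≤2^L =
  ∘-prefixFree (fixedLength-prefixFree L (length-bits L) (bits-injective L))
               (inject≤-injective σ≤2^L σ≤2^L _ _)

n≤2⌈n/2⌉ : ∀ n → n ≤ 2 * ⌈ n /2⌉
n≤2⌈n/2⌉ zero          = z≤n
n≤2⌈n/2⌉ (suc zero)    = s≤s z≤n
n≤2⌈n/2⌉ (suc (suc n)) =
  s≤s (≤-trans (s≤s (n≤2⌈n/2⌉ n)) (≤-reflexive (sym (+-suc ⌈ n /2⌉ (⌈ n /2⌉ + 0)))))

1≤⌈log₂⌉ : ∀ n → 2 ≤ n → 1 ≤ ⌈log₂ n ⌉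
1≤⌈log₂⌉ n 2≤n = subst (_≤ ⌈log₂ n ⌉) (⌈log₂2^n⌉≡n 1) (⌈log₂⌉-mono-≤ 2≤n)

n≤2^⌈log₂n⌉ : ∀ n → n ≤ 2 ^ ⌈log₂ n ⌉
n≤2^⌈log₂n⌉ = <-rec (λ n → n ≤ 2 ^ ⌈log₂ n ⌉) halve
  where
  halve : ∀ n → (∀ {m} → m < n → m ≤ 2 ^ ⌈log₂ m ⌉) → n ≤ 2 ^ ⌈log₂ n ⌉
  halve zero          _  = z≤n
  halve (suc zero)    _  = s≤s z≤n
  halve n@(suc (suc m)) ih = begin
    n                             ≤⟨ n≤2⌈n/2⌉ n ⟩
    2 * ⌈ n /2⌉                   ≤⟨ *-monoʳ-≤ 2 (ih (⌈n/2⌉<n m)) ⟩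
    2 * 2 ^ ⌈log₂ ⌈ n /2⌉ ⌉       ≡⟨ cong (λ e → 2 ^ suc e) (⌈log₂⌈n/2⌉⌉≡⌈log₂n⌉∸1 n) ⟩
    2 ^ (1 + (⌈log₂ n ⌉ ∸ 1))     ≡⟨ cong (2 ^_) (m+[n∸m]≡n (1≤⌈log₂⌉ n (s≤s (s≤s z≤n)))) ⟩
    2 ^ ⌈log₂ n ⌉                 ∎
    where open ≤-Reasoning

unary : ℕ → List Bool
unary zero    = false ∷ []
unary (suc k) = true ∷ unary k

length-unary : ∀ k → length (unary k) ≡ suc k
length-unary zero    = refl
length-unary (suc k) = cong suc (length-unary k)

unary-prefixFree : PrefixFree unary
unary-prefixFree zero    zero    xs ys e = refl , ∷-injectiveʳ e
unary-prefixFree (suc k) (suc j) xs ys e with unary-prefixFree k j xs ys (∷-injectiveʳ e)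
... | refl , xs≡ys = refl , xs≡ys

-- Offset code relative to a reference point p: a sign bit, then the
-- distance from p in unary.  Values close below p get short code words.
offsetCode : ℕ → ℕ → List Bool
offsetCode p n with n ≤? p
... | yes _ = false ∷ unary (p ∸ n)
... | no  _ = true ∷ unary (n ∸ p)

offsetCode-prefixFree : ∀ p → PrefixFree (offsetCode p)
offsetCode-prefixFree p n n′ xs ys e with n ≤? p | n′ ≤? p
... | yes n≤p | yes n′≤p with unary-prefixFree _ _ xs ys (∷-injectiveʳ e)
...   | gap≡ , xs≡ys = ∸-cancelˡ-≡ n≤p n′≤p gap≡ , xs≡ys
offsetCode-prefixFree p n n′ xs ys () | yes _ | no _
offsetCode-prefixFree p n n′ xs ys () | no _  | yes _
offsetCode-prefixFree p n n′ xs ys e  | no n≰p | no n′≰p with unary-prefixFree _ _ xs ys (∷-injectiveʳ e)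
...   | gap≡ , xs≡ys = (begin
  n           ≡⟨ sym (m∸n+n≡m (<⇒≤ (≰⇒> n≰p))) ⟩
  n ∸ p + p   ≡⟨ cong (_+ p) gap≡ ⟩
  n′ ∸ p + p  ≡⟨ m∸n+n≡m (<⇒≤ (≰⇒> n′≰p)) ⟩
  n′          ∎) , xs≡ys
  where open ≡-Reasoning

length-offsetCode : ∀ p n → n ≤ p → length (offsetCode p n) ≡ 2 + (p ∸ n)
length-offsetCode p n n≤p with n ≤? p
... | yes _   = cong suc (length-unary (p ∸ n))
... | no  n≰p = ⊥-elim (n≰p n≤p)

-- The single fact about KMP needed is
-- that failure values grow by at most one per step:
--   fail(s + 1) ≤ fail(s) + 1,
-- because a border of length k + 1 of P[1, s + 1] shortens to a border of
-- length k of P[1, s].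
module Borders {σ : ℕ} (P : Pattern σ) where

  IsBorder : ℕ → ℕ → Set
  IsBorder s k = take k P ≡ drop (s ∸ k) (take s P)

  isBorder-sound : ∀ s k → isBorder P s k ≡ true → IsBorder s k
  isBorder-sound s k with ≡-dec _≟ᶠ_ (take k P) (drop (s ∸ k) (take s P))
  ... | yes border = λ _ → border
  ... | no  _      = λ ()

  isBorder-complete : ∀ s k → IsBorder s k → isBorder P s k ≡ true
  isBorder-complete s k border with ≡-dec _≟ᶠ_ (take k P) (drop (s ∸ k) (take s P))
  ... | yes _         = refl
  ... | no  ¬border = ⊥-elim (¬border border)

  searchBorder-≤ : ∀ s B → searchBorder P s B ≤ B
  searchBorder-≤ s zero    = z≤n
  searchBorder-≤ s (suc B) with isBorder P s (suc B)
  ... | true  = ≤-refl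
  ... | false = m≤n⇒m≤1+n (searchBorder-≤ s B)

  searchBorder-sound : ∀ s B k → searchBorder P s B ≡ suc k → IsBorder s (suc k)
  searchBorder-sound s (suc B) k e with isBorder P s (suc B) in found
  ... | true  = isBorder-sound s (suc k) (subst (λ x → isBorder P s x ≡ true) e found)
  ... | false = searchBorder-sound s B k e

  searchBorder-maximal : ∀ s B k → IsBorder s k → k ≤ B → k ≤ searchBorder P s B
  searchBorder-maximal s zero    k _      k≤B = k≤B
  searchBorder-maximal s (suc B) k border k≤B with isBorder P s (suc B) in found
  ... | true  = k≤B
  ... | false with m≤n⇒m<n∨m≡n k≤B
  ...   | inj₁ k<1+B = searchBorder-maximal s B k border (s≤s⁻¹ k<1+B)
  ...   | inj₂ refl  with trans (sym (isBorder-complete s k border)) found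
  ...     | ()

  border-shrink : ∀ s k → k ≤ s → IsBorder (suc s) (suc k) → IsBorder s k
  border-shrink s k k≤s border = begin
    take k P                                         ≡⟨ cong (λ x → take x P) (sym (m≤n⇒m⊓n≡m (n≤1+n k))) ⟩
    take (k ⊓ suc k) P                               ≡⟨ sym (take-take k (suc k) P) ⟩
    take k (take (suc k) P)                          ≡⟨ cong (take k) border ⟩
    take k (drop (s ∸ k) (take (suc s) P))           ≡⟨ take-drop k (s ∸ k) (take (suc s) P) ⟩
    drop (s ∸ k) (take (s ∸ k + k) (take (suc s) P)) ≡⟨ cong (λ x → drop (s ∸ k) (take x (take (suc s) P))) (m∸n+n≡m k≤s) ⟩
    drop (s ∸ k) (take s (take (suc s) P))           ≡⟨ cong (drop (s ∸ k)) (take-take s (suc s) P) ⟩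
    drop (s ∸ k) (take (s ⊓ suc s) P)                ≡⟨ cong (λ x → drop (s ∸ k) (take x P)) (m≤n⇒m⊓n≡m (n≤1+n s)) ⟩
    drop (s ∸ k) (take s P)                          ∎
    where open ≡-Reasoning

  fail-≤ : ∀ s → fail P (suc s) ≤ s
  fail-≤ s = searchBorder-≤ (suc s) s

  fail-suc≤ : ∀ s → fail P (suc s) ≤ suc (fail P s)
  fail-suc≤ zero = z≤n
  fail-suc≤ (suc t) with searchBorder P (suc (suc t)) (suc t) in found
  ... | zero  = z≤n
  ... | suc k = s≤s (searchBorder-maximal (suc t) t k
                       (border-shrink (suc t) k (m≤n⇒m≤1+n k≤t) (searchBorder-sound (suc (suc t)) (suc t) k found))
                       k≤t)
    where
    k≤t : k ≤ t
    k≤t = s≤s⁻¹ (subst (_≤ suc t) found (fail-≤ (suc t)))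

toFin-just : ∀ n k (b : Fin n) → toFin n k ≡ just b → toℕ b ≡ k
toFin-just (suc n) zero    .fzero refl = refl
toFin-just (suc n) (suc k) b e with toFin n k in found
toFin-just (suc n) (suc k) .(fsuc c) refl | just c = cong suc (toFin-just n k c found)

toFin-nothing : ∀ n k → toFin n k ≡ nothing → n ≤ k
toFin-nothing zero    k       _ = z≤n
toFin-nothing (suc n) (suc k) e with toFin n k in found
toFin-nothing (suc n) (suc k) e  | nothing = s≤s (toFin-nothing n k found)
toFin-nothing (suc n) (suc k) () | just _

-- Entry j (a local
-- target, if any) is coded by its offset from the reference point
-- "previous target + 1" (0 if the previous entry is empty, r at the start).
-- Admissibly the target lies at most at the reference point; then the code
-- word costs 3 + (p - b) bits and moves the reference point from p to
-- b + 1, so the potential "reference point" pays for it with 4 bits per entry.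

refPoint : ∀ {r} → Maybe (Fin r) → ℕ
refPoint nothing  = 0
refPoint (just b) = suc (toℕ b)

AtMost : ∀ {r} → ℕ → Maybe (Fin r) → Set
AtMost p nothing  = ⊤
AtMost p (just b) = toℕ b ≤ p

atMost-size : ∀ {r} (x : Maybe (Fin r)) → AtMost r x
atMost-size nothing  = tt
atMost-size (just b) = <⇒≤ (toℕ<n b)

failureCode : ∀ {r} → ℕ → Maybe (Fin r) → List Bool
failureCode p = maybeCode (offsetCode p ∘ toℕ)

failureCode-prefixFree : ∀ {r} p → PrefixFree (failureCode {r} p)
failureCode-prefixFree p = maybeCode-prefixFree (∘-prefixFree (offsetCode-prefixFree p) toℕ-injective)

failureCode-cost : ∀ {r} p (x : Maybe (Fin r)) → AtMost p x →
                   length (failureCode p x) + refPoint x ≤ 4 + p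
failureCode-cost p nothing  _   = s≤s z≤n
failureCode-cost p (just b) b≤p = ≤-reflexive (begin
  suc (length (offsetCode p (toℕ b))) + suc (toℕ b) ≡⟨ cong (λ n → suc n + suc (toℕ b)) (length-offsetCode p (toℕ b) b≤p) ⟩
  3 + (p ∸ toℕ b) + suc (toℕ b)                      ≡⟨ +-suc (3 + (p ∸ toℕ b)) (toℕ b) ⟩
  4 + (p ∸ toℕ b + toℕ b)                            ≡⟨ cong (4 +_) (m∸n+n≡m b≤p) ⟩
  4 + p                                              ∎)
  where open ≡-Reasoning

module FailureChain (r : ℕ) = Chain (failureCode {r}) refPoint AtMost

module LightFailures {σ : ℕ} (P : Pattern σ) (l r : ℕ) where
  open Borders P

  failEntry : ℕ → Maybe (Fin r)
  failEntry zero = nothing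
  failEntry (suc s) with l ≤? fail P (suc s)
  ... | yes _ = toFin r (fail P (suc s) ∸ l)
  ... | no  _ = nothing

  lightFail≡failEntry : ∀ j → lightFail P l r j ≡ failEntry (l + toℕ j)
  lightFail≡failEntry j with l + toℕ j
  ... | zero  = refl
  ... | suc s with l ≤? fail P (suc s)
  ...   | yes _ = refl
  ...   | no  _ = refl

  failEntry-atMost : ∀ s q → fail P s ∸ l ≤ q → AtMost q (failEntry s)
  failEntry-atMost zero    q _ = tt
  failEntry-atMost (suc s) q bound with l ≤? fail P (suc s)
  ... | no  _ = tt
  ... | yes _ with toFin r (fail P (suc s) ∸ l) in found
  ...   | nothing = tt
  ...   | just b  = subst (_≤ q) (sym (toFin-just r _ b found)) bound

  -- the reference point after state s bounds the next local target,
  -- since fail(s + 1) ≤ fail(s) + 1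
  failEntry-refPoint : ∀ s → s < l + r → fail P (suc s) ∸ l ≤ refPoint (failEntry s)
  failEntry-refPoint zero _ = ≤-reflexive (0∸n≡0 l)
  failEntry-refPoint (suc t) s<l+r with l ≤? fail P (suc t)
  ... | no l≰fail = ≤-reflexive (m≤n⇒m∸n≡0 (≤-trans (fail-suc≤ (suc t)) (≰⇒> l≰fail)))
  ... | yes l≤fail with toFin r (fail P (suc t) ∸ l) in found
  ...   | just b  = begin
    fail P (suc (suc t)) ∸ l    ≤⟨ ∸-monoˡ-≤ l (fail-suc≤ (suc t)) ⟩
    suc (fail P (suc t)) ∸ l    ≡⟨ +-∸-assoc 1 l≤fail ⟩
    suc (fail P (suc t) ∸ l)    ≡⟨ cong suc (sym (toFin-just r _ b found)) ⟩
    suc (toℕ b)                 ∎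
    where open ≤-Reasoning
  ...   | nothing = ⊥-elim (<⇒≱ local<r (toFin-nothing r _ found))
    where
    local<r : fail P (suc t) ∸ l < r
    local<r = subst (fail P (suc t) ∸ l <_) (m+n∸m≡n l r)
                (∸-monoˡ-< (≤-<-trans (fail-≤ t) (≤-trans (n≤1+n (suc t)) s<l+r)) l≤fail)

lightFail-admissible : ∀ {σ} (P : Pattern σ) l n →
                       FailureChain.Admissible (suc n) (suc n) (tabulate (lightFail P l (suc n)))
lightFail-admissible P l n =
  FailureChain.tabulate-admissible (suc n) (suc n) (lightFail P l (suc n)) (atMost-size _) consecutive
  where
  open LightFailures P l (suc n)
  consecutive : ∀ (i : Fin n) → AtMost (refPoint (lightFail P l (suc n) (inject₁ i))) (lightFail P l (suc n) (fsuc i))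
  consecutive i rewrite lightFail≡failEntry (inject₁ i) | lightFail≡failEntry (fsuc i)
                      | toℕ-inject₁ i | +-suc l (toℕ i) =
    failEntry-atMost (suc (l + toℕ i)) _
      (failEntry-refPoint (l + toℕ i) (+-monoʳ-< l (≤-trans (toℕ<n i) (n≤1+n n))))

forwardCode : ∀ σ → ⊤ → Maybe (Fin σ) → List Bool
forwardCode σ _ = maybeCode (letterCode ⌈log₂ σ ⌉ (n≤2^⌈log₂n⌉ σ))

forwardCode-cost : ∀ σ (x : Maybe (Fin σ)) → length (forwardCode σ tt x) + 0 ≤ suc ⌈log₂ σ ⌉ + 0
forwardCode-cost σ nothing  = s≤s z≤n
forwardCode-cost σ (just a) = s≤s (≤-reflexive (cong (_+ 0) (length-bits ⌈log₂ σ ⌉ _)))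

module ForwardChain (σ : ℕ) = Chain (forwardCode σ) (λ _ → tt) (λ _ _ → ⊤)

segmentCode : ∀ σ r → LightData σ r → List Bool
segmentCode σ r = pairCode (ForwardChain.chain σ tt) (FailureChain.chain r r)

segmentCode-injective : ∀ σ r (d d′ : LightData σ r) → segmentCode σ r d ≡ segmentCode σ r d′ → d ≡ d′
segmentCode-injective σ r = prefixFree⇒injective (pairCode-prefixFree
  (ForwardChain.chain-prefixFree σ (λ _ → maybeCode-prefixFree (letterCode-prefixFree ⌈log₂ σ ⌉ (n≤2^⌈log₂n⌉ σ))) tt)
  (FailureChain.chain-prefixFree r failureCode-prefixFree r))

segmentCode-length : ∀ {σ} n (P : Pattern σ) l →
                     length (segmentCode σ (suc n) (lightData P l (suc n))) ≤
                     suc n * suc ⌈log₂ σ ⌉ + (suc n * 4 + suc n)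
segmentCode-length {σ} n P l = begin
  length (forward ++ failures)                      ≡⟨ length-++ forward ⟩
  length forward + length failures                  ≤⟨ +-mono-≤ forward-length failure-length ⟩
  suc n * suc ⌈log₂ σ ⌉ + 0 + (suc n * 4 + suc n)   ≡⟨ cong (_+ (suc n * 4 + suc n)) (+-identityʳ (suc n * suc ⌈log₂ σ ⌉)) ⟩
  suc n * suc ⌈log₂ σ ⌉ + (suc n * 4 + suc n)       ∎
  where
  open ≤-Reasoning
  forward  = ForwardChain.chain σ tt (tabulate (lightForward P l (suc n)))
  failures = FailureChain.chain (suc n) (suc n) (tabulate (lightFail P l (suc n)))
  forward-length : length forward ≤ suc n * suc ⌈log₂ σ ⌉ + 0
  forward-length = ForwardChain.chain-length σ (λ _ → 0) (suc ⌈log₂ σ ⌉) (λ _ x _ → forwardCode-cost σ x) tt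
    (tabulate (lightForward P l (suc n)))
    (ForwardChain.tabulate-admissible σ tt (lightForward P l (suc n)) tt (λ _ → tt))
  failure-length : length failures ≤ suc n * 4 + suc n
  failure-length = FailureChain.chain-length (suc n) (λ p → p) 4 failureCode-cost (suc n)
    (tabulate (lightFail P l (suc n))) (lightFail-admissible P l n)

segment-bound : ∀ r L → 1 ≤ L → r * suc L + (r * 4 + r) ≤ 7 * r * L
segment-bound r (suc L) _ = begin
  r * (2 + L) + (r * 4 + r)      ≡⟨ solve 2 (λ r L → r :* (con 2 :+ L) :+ (r :* con 4 :+ r) := r :* L :+ con 7 :* r) refl r L ⟩
  r * L + 7 * r                  ≤⟨ +-monoʳ-≤ (r * L) (m≤n+m (7 * r) (6 * (r * L))) ⟩
  r * L + (6 * (r * L) + 7 * r)  ≡⟨ solve 2 (λ r L → r :* L :+ (con 6 :* (r :* L) :+ con 7 :* r) := con 7 :* r :* (con 1 :+ L)) refl r L ⟩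
  7 * r * suc L                  ∎
  where
  open ≤-Reasoning
  open +-*-Solver

lemma3 : Σ ℕ λ c → (0 < c × ((σ r : ℕ) → 2 ≤ σ → 2 ≤ r →
           Σ (LightData σ r → List Bool) λ enc → ((∀ (d : LightData σ r) → Realizable σ r d → length {A = Bool} (enc d) ≤ c * r * ⌈log₂ σ ⌉)
                   × (∀ (d d′ : LightData σ r) → Realizable σ r d → Realizable σ r d′ → enc d ≡ enc d′ → d ≡ d′))))
lemma3 = 7 , s≤s z≤n , encoding
  where
  encoding : (σ r : ℕ) → 2 ≤ σ → 2 ≤ r →
             Σ (LightData σ r → List Bool) λ enc → ((∀ (d : LightData σ r) → Realizable σ r d → length {A = Bool} (enc d) ≤ 7 * r * ⌈log₂ σ ⌉)
                   × (∀ (d d′ : LightData σ r) → Realizable σ r d → Realizable σ r d′ → enc d ≡ enc d′ → d ≡ d′))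
  encoding σ (suc n) 2≤σ _ = segmentCode σ (suc n) , short , λ d d′ _ _ → segmentCode-injective σ (suc n) d d′
    where
    short : ∀ d → Realizable σ (suc n) d → length (segmentCode σ (suc n) d) ≤ 7 * suc n * ⌈log₂ σ ⌉
    short _ (h , P , i , _ , _ , _ , refl) =
      ≤-trans (segmentCode-length n P (i * h)) (segment-bound (suc n) ⌈log₂ σ ⌉ (1≤⌈log₂⌉ σ 2≤σ))
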